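{- Let $\alpha\preccurlyeq\beta$ be compositions of $n$. Then $n! = |\mathrm{Cons}_{\alpha\preccurlyeq\beta}|\cdot \pi(\alpha,\beta)$.
   Context: A composition of $n$ is a sequence $\alpha=(\alpha_1,\dots,\alpha_k)$ of positive integers with sum $n$; $\ell(\alpha)=k$. $\alpha\preccurlyeq\beta$ ($\alpha$ refines $\beta$) means $\beta$ is obtained from $\alpha$ by summing consecutive blocks of parts of $\alpha$; then $\alpha^{(i)}$ denotes the consecutive block of parts of $\alpha$ summing to $\beta_i$. For a composition $\gamma$, $\pi(\gamma)=\prod_{i=1}^{\ell(\gamma)}(\gamma_1+\cdots+\gamma_i)$, and for $\alpha\preccurlyeq\beta$, $\pi(\alpha,\beta)=\prod_{i=1}^{\ell(\beta)}\pi(\alpha^{(i)})$. Consistency: write $\sigma\in S_n$ in one-line notation; cut the word into consecutive subwords $\sigma^1,\dots,\sigma^{\ell(\beta)}$ of lengths $\beta_1,\dots,\beta_{\ell(\beta)}$; cut each $\sigma^i$ into consecutive pieces of lengths given by the parts of $\alpha^{(i)}$, regarded as cycles. $\sigma$ is consistent with $\alpha\preccurlyeq\beta$ if for every $i$ each such cycle of $\sigma^i$ has its largest element last and the largest elements of successive cycles of $\sigma^i$ increase left to right. $\mathrm{Cons}_{\alpha\preccurlyeq\beta}$ is the set of $\sigma\in S_n$ consistent with $\alpha\preccurlyeq\beta$. -}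

module Defs where

open import Data.Nat using (ℕ; zero; suc; _+_; _*_; _<_; _≤ᵇ_; _<ᵇ_)
open import Data.Bool using (Bool; true; false; _∧_; T)
open import Data.Fin using (Fin; toℕ)
open import Data.Fin.Properties using (_≟_)
open import Data.Nat.ListAction using (sum; product)
open import Data.List using (List; []; _∷_; concat; map; take; drop; length; filter; allFin)
open import Data.List.Relation.Unary.All using (All)
open import Data.List.Relation.Unary.Unique.Propositional using (Unique)
import Data.List.Relation.Unary.Unique.DecPropositional as UDec
open import Data.Vec using (Vec; toList)
import Data.Vec as Vec
open import Data.Product using (Σ; _×_; _,_)
open import Relation.Binary.PropositionalEquality using (_≡_)
open import Relation.Nullary using (Dec)
open import Relation.Nullary.Decidable using (_×-dec_; T?)

IsComposition : ℕ → List ℕ → Set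
IsComposition n α = All (λ x → 0 < x) α × sum α ≡ n

-- α ≼ β (α refines β), witnessed by the blocks α^(1), …, α^(ℓ(β)):
-- consecutive blocks of parts of α (concatenating to α) whose sums are the parts of β.
-- (For compositions the blocks are uniquely determined.)
_≼_ : List ℕ → List ℕ → Set
α ≼ β = Σ (List (List ℕ)) λ blocks → concat blocks ≡ α × map sum blocks ≡ β

blocksOf : ∀ {α β} → α ≼ β → List (List ℕ)
blocksOf (bs , _) = bs

-- π(γ) = ∏_i (γ_1 + ⋯ + γ_i)
πc-from : ℕ → List ℕ → ℕ
πc-from s []       = 1
πc-from s (x ∷ xs) = (s + x) * πc-from (s + x) xs

πc : List ℕ → ℕ
πc = πc-from 0

π₂ : ∀ {α β} → α ≼ β → ℕ
π₂ r = product (map πc (blocksOf r))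

cuts : {A : Set} → List ℕ → List A → List (List A)
cuts []       w = []
cuts (k ∷ ks) w = take k w ∷ cuts ks (drop k w)

-- last element of a list (0 if empty; only used on nonempty cycles)
lastOr0 : List ℕ → ℕ
lastOr0 []           = 0
lastOr0 (x ∷ [])     = x
lastOr0 (x ∷ y ∷ xs) = lastOr0 (y ∷ xs)

allᵇ : {A : Set} → (A → Bool) → List A → Bool
allᵇ p []       = true
allᵇ p (x ∷ xs) = p x ∧ allᵇ p xs

largestLastᵇ : List ℕ → Bool
largestLastᵇ c = allᵇ (λ x → x ≤ᵇ lastOr0 c) c

increasingᵇ : List ℕ → Bool
increasingᵇ []           = true
increasingᵇ (x ∷ [])     = true
increasingᵇ (x ∷ y ∷ xs) = (x <ᵇ y) ∧ increasingᵇ (y ∷ xs)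

-- condition on one subword σ^i cut into cycles by the parts of α^(i)
blockOKᵇ : List ℕ → List ℕ → Bool
blockOKᵇ parts w =
  allᵇ largestLastᵇ (cuts parts w) ∧ increasingᵇ (map lastOr0 (cuts parts w))

-- σ (one-line notation, values as naturals) is consistent with the refinement
-- given by blocks: cut σ into subwords of lengths sum(α^(i)) = β_i, then check each.
consistentᵇ : List (List ℕ) → List ℕ → Bool
consistentᵇ blocks σ = allᵇ (λ { (b , w) → blockOKᵇ b w }) (zipB blocks (cuts (map sum blocks) σ))
  where
  zipB : List (List ℕ) → List (List ℕ) → List (List ℕ × List ℕ)
  zipB (b ∷ bs) (w ∷ ws) = (b , w) ∷ zipB bs ws
  zipB _ _ = []

-- S_n in one-line notation: words σ(1)…σ(n) over Fin n without repetition
oneLine : ∀ {n} → Vec (Fin n) n → List ℕ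
oneLine v = map toℕ (toList v)

IsPerm : ∀ {n} → Vec (Fin n) n → Set
IsPerm v = Unique (toList v)

allWords : (n k : ℕ) → List (Vec (Fin n) k)
allWords n zero    = Vec.[] ∷ []
allWords n (suc k) = concat (map (λ i → map (i Vec.∷_) (allWords n k)) (allFin n))

Consistent : ∀ {n α β} → α ≼ β → Vec (Fin n) n → Set
Consistent r v = T (consistentᵇ (blocksOf r) (oneLine v))

Cons : ∀ n {α β} → α ≼ β → List (Vec (Fin n) n)
Cons n r = filter (λ v → UDec.unique? (_≟_ {n}) (toList v) ×-dec T? (consistentᵇ (blocksOf r) (oneLine v))) (allWords n n)

∣Cons∣ : ∀ n {α β} → α ≼ β → ℕ
∣Cons∣ n r = length (Cons n r)

module Submission where

-- The words of S_{n+1}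
-- are the words of S_n with the letter n inserted at one of n+1 positions.  In a
-- consistent word every subword σ^i ends in its maximum, so inserting n is consistent
-- only when n lands at the very end of some subword σ^i; the remaining word must then
-- be consistent with the i-th *reduction* of bs, in which the block α^(i) = (γ, a) is
-- replaced by the block γ followed by a-1 singleton blocks (the rest of the last cycle
-- becomes unconstrained).  Since π(i-th reduction) · β_i = π(bs), induction gives
--   |Cons(bs)| · π(bs) = Σ_i |Cons(i-th reduction)| · π(i-th reduction) · β_i = n! · n.

open import Defs
open import Function.Base using (_∘_)
open import Function.Bundles using (Equivalence; mk⇔)
open import Relation.Binary.PropositionalEquality hiding ([_])
open import Relation.Nullary using (¬_; yes; no; Dec)
open import Relation.Nullary.Decidable using (_×-dec_; T?)
open import Data.Empty using (⊥-elim)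
open import Data.Unit using (tt)
open import Data.Product using (Σ; _×_; _,_; proj₁; proj₂)
open import Data.Bool using (Bool; true; false; _∧_; T; if_then_else_)
open import Data.Bool.Properties using (∧-assoc; ∧-identityʳ; T-∧)
open import Data.Nat using (ℕ; zero; suc; _+_; _*_; _∸_; _≤_; _<_; z≤n; s≤s; z<s; s<s; pred; >-nonZero; _≤ᵇ_; _<ᵇ_; _≡ᵇ_; _!)
open import Data.Nat.Properties
open import Algebra.Properties.CommutativeSemigroup +-commutativeSemigroup using () renaming (interchange to +-interchange)
open import Algebra.Properties.CommutativeSemigroup *-commutativeSemigroup using () renaming (xy∙z≈xz∙y to *-right-comm)
open import Data.Nat.ListAction using (sum; product)
open import Data.Nat.ListAction.Properties using (sum-++; product-++; sum-↭)
open import Data.Fin using (Fin; toℕ; fromℕ<)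
import Data.Fin.Properties as Fin
open import Data.Vec using (Vec; toList)
import Data.Vec as Vec
import Data.Vec.Properties as VecP
open import Data.Vec.Relation.Binary.Equality.Cast using (cast-is-id)
open import Data.List using (List; []; _∷_; _++_; [_]; take; drop; replicate; length; map; concatMap; applyUpTo; filter)
open import Data.List.Properties using (map-++; map-∘; map-cong; map-injective; ∷-injective; ++-identityʳ; length-++; length-++-sucʳ; length-map; length-take; length-drop; take-all; take-take; take-drop; drop-drop; take++drop≡id)
open import Data.List.Relation.Unary.All using (All; []; _∷_)
import Data.List.Relation.Unary.All as All
import Data.List.Relation.Unary.All.Properties as All
open import Data.List.Relation.Unary.Any using (here)
import Data.List.Relation.Unary.AllPairs as AllPairs
import Data.List.Relation.Unary.AllPairs.Properties as AllPairs
open import Data.List.Relation.Unary.Unique.Propositional using (Unique; []; _∷_)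
import Data.List.Relation.Unary.Unique.Propositional.Properties as Unique
import Data.List.Relation.Unary.Unique.DecPropositional as UDec
open import Data.List.Membership.Propositional using (_∈_; find; lose)
open import Data.List.Membership.Propositional.Properties using (∈-∃++; ∈-map⁺; ∈-map⁻; ∈-filter⁺; ∈-filter⁻; ∈-allFin; ∈-applyUpTo⁺; ∈-applyUpTo⁻; ∈-concatMap⁺; ∈-concatMap⁻)
open import Data.List.Membership.Propositional.Properties.WithK using (unique∧set⇒bag)
open import Data.List.Membership.DecPropositional _≟_ using (_∈?_)
open import Data.List.Relation.Binary.BagAndSetEquality using (∼bag⇒↭)
open import Data.List.Relation.Binary.Permutation.Propositional using (_↭_)
import Data.List.Relation.Binary.Permutation.Propositional.Properties as Permutation

T-∧⁻ : ∀ x y → T (x ∧ y) → T x × T y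
T-∧⁻ x y = Equivalence.to (T-∧ {x} {y})

T-∧⁺ : ∀ {x y} → T x → T y → T (x ∧ y)
T-∧⁺ {x} {y} tx ty = Equivalence.from (T-∧ {x} {y}) (tx , ty)

T⇒≡true : ∀ {b} → T b → b ≡ true
T⇒≡true {true} _ = refl

¬T⇒≡false : ∀ {b} → ¬ T b → b ≡ false
¬T⇒≡false {false} _   = refl
¬T⇒≡false {true}  ¬tt = ⊥-elim (¬tt tt)

allᵇ⁻ : ∀ {A : Set} (p : A → Bool) xs → T (allᵇ p xs) → All (T ∘ p) xs
allᵇ⁻ p []       _ = []
allᵇ⁻ p (x ∷ xs) t = let (px , pxs) = T-∧⁻ (p x) _ t in px ∷ allᵇ⁻ p xs pxs

allᵇ⁺ : ∀ {A : Set} (p : A → Bool) xs → All (T ∘ p) xs → T (allᵇ p xs)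
allᵇ⁺ p []       []         = tt
allᵇ⁺ p (x ∷ xs) (px ∷ pxs) = T-∧⁺ px (allᵇ⁺ p xs pxs)

allᵇ-++ : ∀ {A : Set} (p : A → Bool) xs ys → allᵇ p (xs ++ ys) ≡ (allᵇ p xs ∧ allᵇ p ys)
allᵇ-++ p []       ys = refl
allᵇ-++ p (x ∷ xs) ys = trans (cong (p x ∧_) (allᵇ-++ p xs ys)) (sym (∧-assoc (p x) _ _))

𝟙 : Bool → ℕ
𝟙 true  = 1
𝟙 false = 0

𝟙-∧ : ∀ x y → 𝟙 (x ∧ y) ≡ 𝟙 x * 𝟙 y
𝟙-∧ true  y = sym (*-identityˡ (𝟙 y))
𝟙-∧ false y = refl

count : {A : Set} → (A → Bool) → List A → ℕ
count p xs = sum (map (𝟙 ∘ p) xs)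

count-++ : ∀ {A : Set} (p : A → Bool) xs ys → count p (xs ++ ys) ≡ count p xs + count p ys
count-++ p xs ys = trans (cong sum (map-++ (𝟙 ∘ p) xs ys)) (sum-++ (map (𝟙 ∘ p) xs) _)

count-concatMap : ∀ {A B : Set} (p : B → Bool) (g : A → List B) xs →
                  count p (concatMap g xs) ≡ sum (map (count p ∘ g) xs)
count-concatMap p g []       = refl
count-concatMap p g (x ∷ xs) =
  trans (count-++ p (g x) _) (cong (count p (g x) +_) (count-concatMap p g xs))

count-↭ : ∀ {A : Set} (p : A → Bool) {xs ys} → xs ↭ ys → count p xs ≡ count p ys
count-↭ p xs↭ys = sum-↭ (Permutation.map⁺ (𝟙 ∘ p) xs↭ys)

sumTo : ℕ → (ℕ → ℕ) → ℕ
sumTo zero    f = 0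
sumTo (suc k) f = f 0 + sumTo k (f ∘ suc)

sumTo-+ : ∀ a b f → sumTo (a + b) f ≡ sumTo a f + sumTo b (λ q → f (a + q))
sumTo-+ zero    b f = refl
sumTo-+ (suc a) b f = trans (cong (f 0 +_) (sumTo-+ a b (f ∘ suc))) (sym (+-assoc (f 0) _ _))

sumTo-cong : ∀ k {f g} → (∀ p → p < k → f p ≡ g p) → sumTo k f ≡ sumTo k g
sumTo-cong zero    _  = refl
sumTo-cong (suc k) eq = cong₂ _+_ (eq 0 z<s) (sumTo-cong k (λ p p<k → eq (suc p) (s<s p<k)))

sumTo-*ˡ : ∀ k K f → sumTo k (λ q → K * f q) ≡ K * sumTo k f
sumTo-*ˡ zero    K f = sym (*-zeroʳ K)
sumTo-*ˡ (suc k) K f =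
  trans (cong (K * f 0 +_) (sumTo-*ˡ k K (f ∘ suc))) (sym (*-distribˡ-+ K (f 0) _))

sumTo-last : ∀ m g → (∀ p → p < m → g p ≡ 0) → sumTo (suc m) g ≡ g m
sumTo-last zero    g _    = +-identityʳ (g 0)
sumTo-last (suc m) g vanish =
  cong₂ _+_ (vanish 0 z<s) (sumTo-last m (g ∘ suc) (λ p p<m → vanish (suc p) (s<s p<m)))

count-applyUpTo : ∀ {A : Set} (p : A → Bool) (h : ℕ → A) k →
                  count p (applyUpTo h k) ≡ sumTo k (𝟙 ∘ p ∘ h)
count-applyUpTo p h zero    = refl
count-applyUpTo p h (suc k) = cong (𝟙 (p (h 0)) +_) (count-applyUpTo p (h ∘ suc) k)

sum-map-+ : ∀ {A : Set} (f g : A → ℕ) xs →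
            sum (map (λ x → f x + g x) xs) ≡ sum (map f xs) + sum (map g xs)
sum-map-+ f g []       = refl
sum-map-+ f g (x ∷ xs) =
  trans (cong ((f x + g x) +_) (sum-map-+ f g xs)) (+-interchange (f x) (g x) (sum (map f xs)) _)

sum-map-*ˡ : ∀ {A : Set} (K : ℕ) (f : A → ℕ) xs → K * sum (map f xs) ≡ sum (map (λ x → K * f x) xs)
sum-map-*ˡ K f []       = *-zeroʳ K
sum-map-*ˡ K f (x ∷ xs) = trans (*-distribˡ-+ K (f x) _) (cong (K * f x +_) (sum-map-*ˡ K f xs))

sum-map-*ʳ : ∀ {A : Set} (K : ℕ) (f : A → ℕ) xs → sum (map f xs) * K ≡ sum (map (λ x → f x * K) xs)
sum-map-*ʳ K f []       = refl
sum-map-*ʳ K f (x ∷ xs) = trans (*-distribʳ-+ K (f x) _) (cong (f x * K +_) (sum-map-*ʳ K f xs))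

sum-map-cong : ∀ {A : Set} {P : A → Set} {f g : A → ℕ} {xs} →
               All P xs → (∀ {x} → P x → f x ≡ g x) → sum (map f xs) ≡ sum (map g xs)
sum-map-cong []         eq = refl
sum-map-cong (px ∷ pxs) eq = cong₂ _+_ (eq px) (sum-map-cong pxs eq)

count-swap : ∀ {A B : Set} (q : A → B → Bool) (R : List A) (W : List B) →
             sum (map (λ w → count (λ r → q r w) R) W) ≡ sum (map (λ r → count (q r) W) R)
count-swap q R []       = sym (zeros R)
  where
  zeros : ∀ R → sum (map (λ r → count (q r) []) R) ≡ 0
  zeros []      = refl
  zeros (_ ∷ R) = zeros R
count-swap q R (w ∷ W) =
  trans (cong (count (λ r → q r w) R +_) (count-swap q R W))
        (sym (sum-map-+ (λ r → 𝟙 (q r w)) (λ r → count (q r) W) R))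

ins : ℕ → ℕ → List ℕ → List ℕ
ins zero    x w       = x ∷ w
ins (suc p) x []      = x ∷ []
ins (suc p) x (y ∷ w) = y ∷ ins p x w

length-ins : ∀ p x w → length (ins p x w) ≡ suc (length w)
length-ins zero    x w       = refl
length-ins (suc p) x []      = refl
length-ins (suc p) x (y ∷ w) = cong suc (length-ins p x w)

ins-++ : ∀ xs x ys → ins (length xs) x (xs ++ ys) ≡ xs ++ x ∷ ys
ins-++ []       x ys = refl
ins-++ (y ∷ xs) x ys = cong (y ∷_) (ins-++ xs x ys)

ins-end : ∀ x u → ins (length u) x u ≡ u ++ [ x ]
ins-end x u = trans (cong (ins (length u) x) (sym (++-identityʳ u))) (ins-++ u x [])

take-ins-inside : ∀ p m x w → p ≤ m → take (suc m) (ins p x w) ≡ ins p x (take m w)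
take-ins-inside zero    m       x w       _         = refl
take-ins-inside (suc p) (suc m) x []      _         = refl
take-ins-inside (suc p) (suc m) x (y ∷ w) (s≤s p≤m) = cong (y ∷_) (take-ins-inside p m x w p≤m)

drop-ins-inside : ∀ p m x w → p ≤ m → drop (suc m) (ins p x w) ≡ drop m w
drop-ins-inside zero    m       x w       _         = refl
drop-ins-inside (suc p) (suc m) x []      _         = refl
drop-ins-inside (suc p) (suc m) x (y ∷ w) (s≤s p≤m) = drop-ins-inside p m x w p≤m

take-ins-beyond : ∀ k q x w → k ≤ length w → take k (ins (k + q) x w) ≡ take k w
take-ins-beyond zero    q x w       _         = refl
take-ins-beyond (suc k) q x (y ∷ w) (s≤s k≤w) = cong (y ∷_) (take-ins-beyond k q x w k≤w)

drop-ins-beyond : ∀ k q x w → k ≤ length w → drop k (ins (k + q) x w) ≡ ins q x (drop k w)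
drop-ins-beyond zero    q x w       _         = refl
drop-ins-beyond (suc k) q x (y ∷ w) (s≤s k≤w) = drop-ins-beyond k q x w k≤w

All-ins : ∀ {P : ℕ → Set} p x w → P x → All P w → All P (ins p x w)
All-ins zero    x w       px pw         = px ∷ pw
All-ins (suc p) x []      px []         = px ∷ []
All-ins (suc p) x (y ∷ w) px (py ∷ pw) = py ∷ All-ins p x w px pw

All-ins⁻ : ∀ {P : ℕ → Set} p x w → All P (ins p x w) → P x
All-ins⁻ zero    x w       (px ∷ _)  = px
All-ins⁻ (suc p) x []      (px ∷ _)  = px
All-ins⁻ (suc p) x (y ∷ w) (_ ∷ pxw) = All-ins⁻ p x w pxw

lastOr0-++ : ∀ xs y ys → lastOr0 (xs ++ y ∷ ys) ≡ lastOr0 (y ∷ ys)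
lastOr0-++ []            y ys = refl
lastOr0-++ (x ∷ [])      y ys = refl
lastOr0-++ (x ∷ x′ ∷ xs) y ys = lastOr0-++ (x′ ∷ xs) y ys

last-All : ∀ {P : ℕ → Set} xs → 0 < length xs → All P xs → P (lastOr0 xs)
last-All (x ∷ [])      _ (px ∷ [])  = px
last-All (x ∷ x′ ∷ xs) _ (_ ∷ pxs) = last-All (x′ ∷ xs) z<s pxs

last-take : ∀ {P : ℕ → Set} k d → 0 < k → 0 < length d → All P d → P (lastOr0 (take k d))
last-take (suc k) (z ∷ d) _ _ pd = last-All (z ∷ take k d) z<s (All.take⁺ (suc k) pd)

lastOr0-++ʳ : ∀ u d → 0 < length d → lastOr0 (u ++ d) ≡ lastOr0 d
lastOr0-++ʳ u (y ∷ ys) _ = lastOr0-++ u y ys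

last-ins : ∀ p x w → p < length w → lastOr0 (ins p x w) ≡ lastOr0 w
last-ins zero    x (y ∷ w)     _         = lastOr0-++ [ x ] y w
last-ins (suc p) x (y ∷ z ∷ w) (s<s p<w) =
  trans (lastOr0-++ʳ [ y ] (ins p x (z ∷ w)) (subst (0 <_) (sym (length-ins p x (z ∷ w))) z<s))
        (last-ins p x (z ∷ w) p<w)

take-++ˡ : ∀ k (u v : List ℕ) → k ≤ length u → take k (u ++ v) ≡ take k u
take-++ˡ zero    u       v _         = refl
take-++ˡ (suc k) (y ∷ u) v (s≤s k≤u) = cong (y ∷_) (take-++ˡ k u v k≤u)

drop-++ˡ : ∀ k (u v : List ℕ) → k ≤ length u → drop k (u ++ v) ≡ drop k u ++ v
drop-++ˡ zero    u       v _         = refl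
drop-++ˡ (suc k) (y ∷ u) v (s≤s k≤u) = drop-++ˡ k u v k≤u

take-prefix : ∀ m k (w : List ℕ) → take m (take (m + k) w) ≡ take m w
take-prefix m k w = trans (take-take m (m + k) w) (cong (λ j → take j w) (m≤n⇒m⊓n≡m (m≤m+n m k)))

take-idem : ∀ m (w : List ℕ) → take m (take m w) ≡ take m w
take-idem m w = trans (take-take m m w) (cong (λ j → take j w) (⊓-idem m))

length-take-≤ : ∀ m (w : List ℕ) → m ≤ length w → length (take m w) ≡ m
length-take-≤ m w m≤w = trans (length-take m w) (m≤n⇒m⊓n≡m m≤w)

length-drop-+ : ∀ m k (w : List ℕ) → length w ≡ m + k → length (drop m w) ≡ k
length-drop-+ m k w len = trans (length-drop m w) (trans (cong (_∸ m) len) (m+n∸m≡n m k))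

cuts-++ : ∀ xs ys (w : List ℕ) → cuts (xs ++ ys) w ≡ cuts xs w ++ cuts ys (drop (sum xs) w)
cuts-++ []       ys w = refl
cuts-++ (x ∷ xs) ys w = cong (take x w ∷_)
  (trans (cuts-++ xs ys (drop x w)) (cong (λ v → cuts xs (drop x w) ++ cuts ys v) (drop-drop x (sum xs) w)))

cuts-take : ∀ ks (w : List ℕ) → cuts ks (take (sum ks) w) ≡ cuts ks w
cuts-take []       w = refl
cuts-take (k ∷ ks) w = cong₂ _∷_ (take-prefix k (sum ks) w)
  (trans (cong (cuts ks) (sym (take-drop (sum ks) k w))) (cuts-take ks (drop k w)))

cuts-lasts : ∀ {P : ℕ → Set} ks w → All (0 <_) ks → sum ks ≤ length w → All P w →
             All P (map lastOr0 (cuts ks w))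
cuts-lasts []       w _               _   _  = []
cuts-lasts (k ∷ ks) w (k>0 ∷ ks>0) ks≤w pw =
  last-take k w k>0 (<-≤-trans k>0 k≤w) pw
  ∷ cuts-lasts ks (drop k w) ks>0 rest≤ (All.drop⁺ k pw)
  where
  k≤w : k ≤ length w
  k≤w = ≤-trans (m≤m+n k (sum ks)) ks≤w
  rest≤ : sum ks ≤ length (drop k w)
  rest≤ = subst (sum ks ≤_) (sym (length-drop k w))
                (subst (_≤ length w ∸ k) (m+n∸m≡n k (sum ks)) (∸-monoˡ-≤ k ks≤w))

-- The consistency test for block lists.  size bs is the length of the words it reads.

size : List (List ℕ) → ℕ
size bs = sum (map sum bs)

size-++ : ∀ xs ys → size (xs ++ ys) ≡ size xs + size ys
size-++ xs ys = trans (cong sum (map-++ sum xs ys)) (sum-++ (map sum xs) (map sum ys))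

consistent-++ : ∀ xs ys σ →
  consistentᵇ (xs ++ ys) σ ≡ (consistentᵇ xs (take (size xs) σ) ∧ consistentᵇ ys (drop (size xs) σ))
consistent-++ []       ys σ = refl
consistent-++ (b ∷ xs) ys σ = begin
  ok b (take s σ) ∧ C (xs ++ ys) (drop s σ)
    ≡⟨ cong (ok b (take s σ) ∧_) (consistent-++ xs ys (drop s σ)) ⟩
  ok b (take s σ) ∧ (C xs (take t (drop s σ)) ∧ C ys (drop t (drop s σ)))
    ≡⟨ sym (∧-assoc (ok b (take s σ)) _ _) ⟩
  (ok b (take s σ) ∧ C xs (take t (drop s σ))) ∧ C ys (drop t (drop s σ))
    ≡⟨ cong₂ (λ u v → (ok b u ∧ C xs v) ∧ C ys (drop t (drop s σ)))
             (sym (take-prefix s t σ)) (take-drop t s σ) ⟩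
  C (b ∷ xs) (take (s + t) σ) ∧ C ys (drop t (drop s σ))
    ≡⟨ cong (λ v → C (b ∷ xs) (take (s + t) σ) ∧ C ys v) (drop-drop s t σ) ⟩
  C (b ∷ xs) (take (s + t) σ) ∧ C ys (drop (s + t) σ) ∎
  where
  open ≡-Reasoning
  ok = blockOKᵇ
  C  = consistentᵇ
  s  = sum b
  t  = size xs

consistent-singletons : ∀ k σ → consistentᵇ (replicate k [ 1 ]) σ ≡ true
consistent-singletons zero    σ       = refl
consistent-singletons (suc k) []      = consistent-singletons k []
consistent-singletons (suc k) (x ∷ σ) rewrite T⇒≡true (≤⇒≤ᵇ (≤-refl {x})) = consistent-singletons k σ

largestLast⇒ : ∀ c → T (largestLastᵇ c) → All (_≤ lastOr0 c) c
largestLast⇒ c t = All.map (λ {x} → ≤ᵇ⇒≤ x (lastOr0 c)) (allᵇ⁻ _ c t)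

blockOK-split : ∀ k k′ ks w → T (blockOKᵇ (k ∷ k′ ∷ ks) w) →
  T (largestLastᵇ (take k w)) × lastOr0 (take k w) < lastOr0 (take k′ (drop k w))
    × T (blockOKᵇ (k′ ∷ ks) (drop k w))
blockOK-split k k′ ks w ok =
  proj₁ cycles₁ , <ᵇ⇒< _ _ (proj₁ incr₁) , T-∧⁺ (proj₂ cycles₁) (proj₂ incr₁)
  where
  u = take k w
  d = drop k w
  cycles = T-∧⁻ (allᵇ largestLastᵇ (cuts (k ∷ k′ ∷ ks) w)) _ ok
  cycles₁ = T-∧⁻ (largestLastᵇ u) _ (proj₁ cycles)
  incr₁ = T-∧⁻ (lastOr0 u <ᵇ lastOr0 (take k′ d)) _ (proj₂ cycles)

-- In a block passing the test every letter is at most the last one: each cycle ends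
-- in its maximum and these maxima increase.
blockOK⇒lastMax : ∀ parts w → All (0 <_) parts → length w ≡ sum parts →
                  T (blockOKᵇ parts w) → All (_≤ lastOr0 w) w
blockOK⇒lastMax []       [] _ _   _  = []
blockOK⇒lastMax (k ∷ []) w _ len ok =
  subst (λ v → All (_≤ lastOr0 v) v) (take-all k w (≤-reflexive (trans len (+-identityʳ k))))
        (largestLast⇒ (take k w) (proj₁ (T-∧⁻ _ _ (proj₁ (T-∧⁻ _ _ ok)))))
blockOK⇒lastMax (k ∷ k′ ∷ ks) w (_ ∷ rest>0) len ok =
  subst (λ v → All (_≤ lastOr0 v) v) (take++drop≡id k w)
        (subst (λ m → All (_≤ m) (u ++ d)) (sym (lastOr0-++ʳ u d d≢[]))
               (All.++⁺ (All.map (λ z≤x → ≤-trans z≤x x≤) (largestLast⇒ u firstOK)) restMax))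
  where
  u = take k w
  d = drop k w
  split = blockOK-split k k′ ks w ok
  firstOK = proj₁ split
  k′>0 = All.head rest>0
  len-d : length d ≡ sum (k′ ∷ ks)
  len-d = length-drop-+ k _ w len
  d≢[] : 0 < length d
  d≢[] = subst (0 <_) (sym len-d) (≤-trans k′>0 (m≤m+n k′ _))
  restMax : All (_≤ lastOr0 d) d
  restMax = blockOK⇒lastMax (k′ ∷ ks) d rest>0 len-d (proj₂ (proj₂ split))
  x≤ : lastOr0 u ≤ lastOr0 d
  x≤ = ≤-trans (<⇒≤ (proj₁ (proj₂ split))) (last-take k′ d k′>0 d≢[] restMax)

blockOK-early-max : ∀ parts p n u → All (0 <_) parts → suc (length u) ≡ sum parts →
                    All (_< n) u → p < length u → blockOKᵇ parts (ins p n u) ≡ false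
blockOK-early-max parts p n u pos len u<n p<u = ¬T⇒≡false λ ok →
  <⇒≱ (last-All u (≤-<-trans z≤n p<u) u<n)
      (subst (n ≤_) (last-ins p n u p<u)
             (All-ins⁻ p n u (blockOK⇒lastMax parts (ins p n u) pos (trans (length-ins p n u) len) ok)))

increasing-append-max : ∀ n xs → All (_< n) xs → increasingᵇ (xs ++ [ n ]) ≡ increasingᵇ xs
increasing-append-max n []           _          = refl
increasing-append-max n (x ∷ [])     (x<n ∷ _)  rewrite T⇒≡true (<⇒<ᵇ x<n) = refl
increasing-append-max n (x ∷ y ∷ xs) (_ ∷ rest) rewrite increasing-append-max n (y ∷ xs) rest = refl

largestLast-append-max : ∀ n xs → All (_< n) xs → largestLastᵇ (xs ++ [ n ]) ≡ true
largestLast-append-max n xs xs<n =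
  T⇒≡true (subst (λ m → T (allᵇ (_≤ᵇ m) (xs ++ [ n ]))) (sym (lastOr0-++ xs n []))
    (allᵇ⁺ _ (xs ++ [ n ]) (All.++⁺ (All.map (λ x<n → ≤⇒≤ᵇ (<⇒≤ x<n)) xs<n) (≤⇒≤ᵇ (≤-refl {n}) ∷ []))))

-- Appending a new maximum to the block γ ++ [a]: the test succeeds iff γ passes the
-- test on its prefix; the last cycle now ends in its maximum and is unconstrained.
blockOK-append-max : ∀ γ a n u → All (0 <_) γ → 0 < a → length u ≡ sum γ + pred a →
                     All (_< n) u → blockOKᵇ (γ ++ [ a ]) (u ++ [ n ]) ≡ blockOKᵇ γ (take (sum γ) u)
blockOK-append-max γ a n u γ>0 a>0 len u<n = begin
  blockOKᵇ (γ ++ [ a ]) (u ++ [ n ])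
    ≡⟨ cong (λ cs → allᵇ largestLastᵇ cs ∧ increasingᵇ (map lastOr0 cs)) cutsEq ⟩
  allᵇ largestLastᵇ (C ++ [ E ]) ∧ increasingᵇ (map lastOr0 (C ++ [ E ]))
    ≡⟨ cong₂ _∧_ cyclesEq incrEq ⟩
  allᵇ largestLastᵇ C ∧ increasingᵇ (map lastOr0 C) ∎
  where
  open ≡-Reasoning
  s = sum γ
  C = cuts γ (take s u)
  D = drop s u
  E = D ++ [ n ]
  s≤u : s ≤ length u
  s≤u = subst (s ≤_) (sym len) (m≤m+n s (pred a))
  lenE : length E ≡ a
  lenE = trans (length-++ D) (trans (cong (_+ 1) (length-drop-+ s (pred a) u len))
                                    (trans (+-comm (pred a) 1) (suc-pred a {{>-nonZero a>0}})))
  cutsEq : cuts (γ ++ [ a ]) (u ++ [ n ]) ≡ C ++ [ E ]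
  cutsEq = trans (cuts-++ γ [ a ] (u ++ [ n ]))
    (cong₂ _++_ (trans (sym (cuts-take γ (u ++ [ n ]))) (cong (cuts γ) (take-++ˡ s u [ n ] s≤u)))
                (cong [_] (trans (cong (take a) (drop-++ˡ s u [ n ] s≤u)) (take-all a E (≤-reflexive lenE)))))
  cyclesEq : allᵇ largestLastᵇ (C ++ [ E ]) ≡ allᵇ largestLastᵇ C
  cyclesEq = trans (allᵇ-++ largestLastᵇ C [ E ])
    (trans (cong (λ t → allᵇ largestLastᵇ C ∧ (t ∧ true)) (largestLast-append-max n D (All.drop⁺ s u<n)))
           (∧-identityʳ _))
  lasts<n : All (_< n) (map lastOr0 C)
  lasts<n = cuts-lasts γ (take s u) γ>0 (≤-reflexive (sym (length-take-≤ s u s≤u))) (All.take⁺ s u<n)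
  incrEq : increasingᵇ (map lastOr0 (C ++ [ E ])) ≡ increasingᵇ (map lastOr0 C)
  incrEq = trans (cong increasingᵇ (map-++ lastOr0 C [ E ]))
    (trans (cong (λ m → increasingᵇ (map lastOr0 C ++ [ m ])) (lastOr0-++ D n []))
           (increasing-append-max n (map lastOr0 C) lasts<n))

Block : List ℕ → Set
Block b = All (0 <_) b × 0 < sum b

dropLast : List ℕ → List ℕ
dropLast []           = []
dropLast (x ∷ [])     = []
dropLast (x ∷ y ∷ xs) = x ∷ dropLast (y ∷ xs)

dropLast-++-last : ∀ x xs → x ∷ xs ≡ dropLast (x ∷ xs) ++ [ lastOr0 (x ∷ xs) ]
dropLast-++-last x []       = refl
dropLast-++-last x (y ∷ xs) = cong (x ∷_) (dropLast-++-last y xs)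

-- γ as a block list (with no block at all when γ is empty, keeping blocks nonempty).
asBlocks : List ℕ → List (List ℕ)
asBlocks []       = []
asBlocks (x ∷ xs) = [ x ∷ xs ]

reduceBlock : List ℕ → List (List ℕ)
reduceBlock b = asBlocks (dropLast b) ++ replicate (pred (lastOr0 b)) [ 1 ]

reductions : List (List ℕ) → List (List (List ℕ))
reductions []       = []
reductions (b ∷ bs) = (reduceBlock b ++ bs) ∷ map (b ∷_) (reductions bs)

block-init-last : ∀ x xs → All (0 <_) (x ∷ xs) →
  All (0 <_) (dropLast (x ∷ xs)) × 0 < lastOr0 (x ∷ xs)
    × sum (x ∷ xs) ≡ sum (dropLast (x ∷ xs)) + lastOr0 (x ∷ xs)
block-init-last x xs pos =
  proj₁ (All.++⁻ γ (subst (All (0 <_)) (dropLast-++-last x xs) pos)) ,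
  last-All (x ∷ xs) z<s pos ,
  trans (cong sum (dropLast-++-last x xs)) (trans (sum-++ γ [ a ]) (cong (sum γ +_) (+-identityʳ a)))
  where
  γ = dropLast (x ∷ xs)
  a = lastOr0 (x ∷ xs)

size-asBlocks : ∀ γ → size (asBlocks γ) ≡ sum γ
size-asBlocks []       = refl
size-asBlocks (x ∷ xs) = +-identityʳ _

size-singletons : ∀ k → size (replicate k [ 1 ]) ≡ k
size-singletons zero    = refl
size-singletons (suc k) = cong suc (size-singletons k)

sum-block : ∀ x xs → All (0 <_) (x ∷ xs) →
            sum (x ∷ xs) ≡ suc (sum (dropLast (x ∷ xs)) + pred (lastOr0 (x ∷ xs)))
sum-block x xs pos = begin
  sum (x ∷ xs)            ≡⟨ proj₂ (proj₂ split) ⟩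
  sum γ + a               ≡⟨ cong (sum γ +_) (sym (suc-pred a {{>-nonZero (proj₁ (proj₂ split))}})) ⟩
  sum γ + suc (pred a)    ≡⟨ +-suc (sum γ) (pred a) ⟩
  suc (sum γ + pred a)    ∎
  where
  open ≡-Reasoning
  γ = dropLast (x ∷ xs)
  a = lastOr0 (x ∷ xs)
  split = block-init-last x xs pos

size-reduceBlock : ∀ b → size (reduceBlock b) ≡ sum (dropLast b) + pred (lastOr0 b)
size-reduceBlock b = trans (size-++ (asBlocks (dropLast b)) _)
                           (cong₂ _+_ (size-asBlocks (dropLast b)) (size-singletons (pred (lastOr0 b))))

reduceBlock-one-shorter : ∀ x xs → All (0 <_) (x ∷ xs) → suc (size (reduceBlock (x ∷ xs))) ≡ sum (x ∷ xs)
reduceBlock-one-shorter x xs pos = trans (cong suc (size-reduceBlock (x ∷ xs))) (sym (sum-block x xs pos))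

asBlocks-valid : ∀ γ → All (0 <_) γ → All Block (asBlocks γ)
asBlocks-valid []       _   = []
asBlocks-valid (y ∷ ys) pos = (pos , ≤-trans (All.head pos) (m≤m+n y (sum ys))) ∷ []

reductions-valid : ∀ bs → All Block bs → All (λ r → All Block r × suc (size r) ≡ size bs) (reductions bs)
reductions-valid []                _                      = []
reductions-valid ([] ∷ bs)         ((_ , ()) ∷ _)
reductions-valid ((x ∷ xs) ∷ bs) (blk@(pos , _) ∷ valid) =
  (All.++⁺ (All.++⁺ (asBlocks-valid _ (proj₁ (block-init-last x xs pos)))
                    (All.replicate⁺ _ ((z<s ∷ []) , z<s)))
           valid ,
   trans (cong suc (size-++ (reduceBlock b) bs)) (cong (_+ size bs) (reduceBlock-one-shorter x xs pos)))
  ∷ All.map⁺ (All.map (λ { {r} (valid-r , size-r) →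
        blk ∷ valid-r , trans (sym (+-suc (sum b) (size r))) (cong (sum b +_) size-r) })
      (reductions-valid bs valid))
  where
  b = x ∷ xs

consistent-asBlocks : ∀ γ v → consistentᵇ (asBlocks γ) v ≡ blockOKᵇ γ (take (sum γ) v)
consistent-asBlocks []       v = refl
consistent-asBlocks (x ∷ xs) v = ∧-identityʳ _

consistent-reduceBlock : ∀ x xs n u → All (0 <_) (x ∷ xs) → suc (length u) ≡ sum (x ∷ xs) →
  All (_< n) u → blockOKᵇ (x ∷ xs) (u ++ [ n ]) ≡ consistentᵇ (reduceBlock (x ∷ xs)) u
consistent-reduceBlock x xs n u pos len u<n = begin
  blockOKᵇ (x ∷ xs) (u ++ [ n ])
    ≡⟨ cong (λ b → blockOKᵇ b (u ++ [ n ])) (dropLast-++-last x xs) ⟩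
  blockOKᵇ (γ ++ [ a ]) (u ++ [ n ])
    ≡⟨ blockOK-append-max γ a n u (proj₁ split) (proj₁ (proj₂ split)) len-u u<n ⟩
  blockOKᵇ γ (take (sum γ) u)
    ≡⟨ cong (blockOKᵇ γ) (sym (take-idem (sum γ) u)) ⟩
  blockOKᵇ γ (take (sum γ) (take (sum γ) u))
    ≡⟨ sym (consistent-asBlocks γ (take (sum γ) u)) ⟩
  consistentᵇ (asBlocks γ) (take (sum γ) u)
    ≡⟨ sym (∧-identityʳ _) ⟩
  consistentᵇ (asBlocks γ) (take (sum γ) u) ∧ true
    ≡⟨ cong₂ (λ s t → consistentᵇ (asBlocks γ) (take s u) ∧ t) (sym (size-asBlocks γ))
             (sym (consistent-singletons (pred a) _)) ⟩
  consistentᵇ (asBlocks γ) (take s u) ∧ consistentᵇ (replicate (pred a) [ 1 ]) (drop s u)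
    ≡⟨ sym (consistent-++ (asBlocks γ) _ u) ⟩
  consistentᵇ (reduceBlock (x ∷ xs)) u ∎
  where
  open ≡-Reasoning
  γ = dropLast (x ∷ xs)
  a = lastOr0 (x ∷ xs)
  s = size (asBlocks γ)
  split = block-init-last x xs pos
  len-u : length u ≡ sum γ + pred a
  len-u = suc-injective (trans len (sum-block x xs pos))

πblocks : List (List ℕ) → ℕ
πblocks bs = product (map πc bs)

πblocks-++ : ∀ xs ys → πblocks (xs ++ ys) ≡ πblocks xs * πblocks ys
πblocks-++ xs ys = trans (cong product (map-++ πc xs ys)) (product-++ (map πc xs) (map πc ys))

πblocks-singletons : ∀ k → πblocks (replicate k [ 1 ]) ≡ 1
πblocks-singletons zero    = refl
πblocks-singletons (suc k) = trans (+-identityʳ _) (πblocks-singletons k)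

πblocks-asBlocks : ∀ γ → πblocks (asBlocks γ) ≡ πc γ
πblocks-asBlocks []       = refl
πblocks-asBlocks (x ∷ xs) = *-identityʳ _

πc-from-snoc : ∀ s xs a → πc-from s (xs ++ [ a ]) ≡ πc-from s xs * (s + sum xs + a)
πc-from-snoc s []       a =
  trans (*-identityʳ (s + a)) (trans (cong (_+ a) (sym (+-identityʳ s))) (sym (*-identityˡ _)))
πc-from-snoc s (x ∷ xs) a = begin
  (s + x) * πc-from (s + x) (xs ++ [ a ])
    ≡⟨ cong ((s + x) *_) (πc-from-snoc (s + x) xs a) ⟩
  (s + x) * (πc-from (s + x) xs * (s + x + sum xs + a))
    ≡⟨ sym (*-assoc (s + x) _ _) ⟩
  (s + x) * πc-from (s + x) xs * (s + x + sum xs + a)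
    ≡⟨ cong (λ t → (s + x) * πc-from (s + x) xs * (t + a)) (+-assoc s x (sum xs)) ⟩
  (s + x) * πc-from (s + x) xs * (s + (x + sum xs) + a) ∎
  where open ≡-Reasoning

πblocks-reduceBlock : ∀ x xs → All (0 <_) (x ∷ xs) → πblocks (reduceBlock (x ∷ xs)) * sum (x ∷ xs) ≡ πc (x ∷ xs)
πblocks-reduceBlock x xs pos = begin
  πblocks (asBlocks γ ++ replicate (pred a) [ 1 ]) * sum (x ∷ xs)
    ≡⟨ cong₂ _*_ (trans (πblocks-++ (asBlocks γ) _) (cong₂ _*_ (πblocks-asBlocks γ) (πblocks-singletons (pred a))))
                 (proj₂ (proj₂ (block-init-last x xs pos))) ⟩
  πc γ * 1 * (sum γ + a)
    ≡⟨ cong (_* (sum γ + a)) (*-identityʳ (πc γ)) ⟩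
  πc γ * (sum γ + a)
    ≡⟨ sym (πc-from-snoc 0 γ a) ⟩
  πc (γ ++ [ a ])
    ≡⟨ cong πc (sym (dropLast-++-last x xs)) ⟩
  πc (x ∷ xs) ∎
  where
  open ≡-Reasoning
  γ = dropLast (x ∷ xs)
  a = lastOr0 (x ∷ xs)

πblocks-first-reduction : ∀ x xs bs → All (0 <_) (x ∷ xs) →
  πblocks ((x ∷ xs) ∷ bs) ≡ πblocks (reduceBlock (x ∷ xs) ++ bs) * sum (x ∷ xs)
πblocks-first-reduction x xs bs pos = begin
  πc b * πblocks bs                                  ≡⟨ cong (_* πblocks bs) (sym (πblocks-reduceBlock x xs pos)) ⟩
  πblocks (reduceBlock b) * sum b * πblocks bs       ≡⟨ *-right-comm (πblocks (reduceBlock b)) (sum b) (πblocks bs) ⟩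
  πblocks (reduceBlock b) * πblocks bs * sum b       ≡⟨ cong (_* sum b) (sym (πblocks-++ (reduceBlock b) bs)) ⟩
  πblocks (reduceBlock b ++ bs) * sum b              ∎
  where
  open ≡-Reasoning
  b = x ∷ xs

-- The reductions of bs, weighted: if h r · π(r) = K for every reduction r, then
-- Σ_r h r · π(bs) = K · size bs, since π(bs) = π(i-th reduction) · |block i|.
reductions-weighted : ∀ bs → All Block bs → (h : List (List ℕ) → ℕ) (K : ℕ) →
  All (λ r → h r * πblocks r ≡ K) (reductions bs) → sum (map h (reductions bs)) * πblocks bs ≡ K * size bs
reductions-weighted []                _                h K _ = sym (*-zeroʳ K)
reductions-weighted ([] ∷ bs)         ((_ , ()) ∷ _)   h K _
reductions-weighted ((x ∷ xs) ∷ bs) ((pos , _) ∷ valid) h K (first ∷ rest) = begin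
  (h r₁ + S) * πblocks (b ∷ bs)                       ≡⟨ *-distribʳ-+ (πblocks (b ∷ bs)) (h r₁) S ⟩
  h r₁ * πblocks (b ∷ bs) + S * πblocks (b ∷ bs)      ≡⟨ cong₂ _+_ reducedHere reducedLater ⟩
  K * sum b + K * size bs                             ≡⟨ sym (*-distribˡ-+ K (sum b) (size bs)) ⟩
  K * (sum b + size bs)                               ∎
  where
  open ≡-Reasoning
  b = x ∷ xs
  r₁ = reduceBlock b ++ bs
  S = sum (map h (map (b ∷_) (reductions bs)))
  reducedHere : h r₁ * πblocks (b ∷ bs) ≡ K * sum b
  reducedHere = begin
    h r₁ * πblocks (b ∷ bs)          ≡⟨ cong (h r₁ *_) (πblocks-first-reduction x xs bs pos) ⟩
    h r₁ * (πblocks r₁ * sum b)      ≡⟨ sym (*-assoc (h r₁) (πblocks r₁) (sum b)) ⟩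
    h r₁ * πblocks r₁ * sum b        ≡⟨ cong (_* sum b) first ⟩
    K * sum b                        ∎
  -- The other reductions keep the block b; absorb its weight πc b into h.
  h′ : List (List ℕ) → ℕ
  h′ r = h (b ∷ r) * πc b
  reducedLater : S * (πc b * πblocks bs) ≡ K * size bs
  reducedLater = begin
    S * (πc b * πblocks bs)
      ≡⟨ sym (*-assoc S (πc b) (πblocks bs)) ⟩
    S * πc b * πblocks bs
      ≡⟨ cong (λ t → sum t * πc b * πblocks bs) (sym (map-∘ (reductions bs))) ⟩
    sum (map (h ∘ (b ∷_)) (reductions bs)) * πc b * πblocks bs
      ≡⟨ cong (_* πblocks bs) (sum-map-*ʳ (πc b) (h ∘ (b ∷_)) (reductions bs)) ⟩
    sum (map h′ (reductions bs)) * πblocks bs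
      ≡⟨ reductions-weighted bs valid h′ K
           (All.map (λ {r} e → trans (*-assoc (h (b ∷ r)) (πc b) (πblocks r)) e) (All.map⁻ rest)) ⟩
    K * size bs ∎

consistent-ins-inside : ∀ b bs p m n w → sum b ≡ suc m → p ≤ m →
  consistentᵇ (b ∷ bs) (ins p n w) ≡ (blockOKᵇ b (ins p n (take m w)) ∧ consistentᵇ bs (drop m w))
consistent-ins-inside b bs p m n w sb≡ p≤m =
  trans (cong (λ k → blockOKᵇ b (take k (ins p n w)) ∧ consistentᵇ bs (drop k (ins p n w))) sb≡)
        (cong₂ (λ s t → blockOKᵇ b s ∧ consistentᵇ bs t)
               (take-ins-inside p m n w p≤m) (drop-ins-inside p m n w p≤m))

consistent-ins-beyond : ∀ b bs q n w → sum b ≤ length w →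
  consistentᵇ (b ∷ bs) (ins (sum b + q) n w)
    ≡ (blockOKᵇ b (take (sum b) w) ∧ consistentᵇ bs (ins q n (drop (sum b) w)))
consistent-ins-beyond b bs q n w sb≤w =
  cong₂ (λ s t → blockOKᵇ b s ∧ consistentᵇ bs t)
        (take-ins-beyond (sum b) q n w sb≤w) (drop-ins-beyond (sum b) q n w sb≤w)

-- Among the positions inside the first block only the last one can give a consistent
-- word, and it does iff the first reduction accepts the original word.
insertions-first-block : ∀ x xs bs n w → All (0 <_) (x ∷ xs) → All (_< n) w → pred (sum (x ∷ xs)) ≤ length w →
  sumTo (sum (x ∷ xs)) (λ p → 𝟙 (consistentᵇ ((x ∷ xs) ∷ bs) (ins p n w)))
    ≡ 𝟙 (consistentᵇ (reduceBlock (x ∷ xs) ++ bs) w)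
insertions-first-block x xs bs n w pos w<n m≤w =
  trans (cong (λ k → sumTo k g) sb≡) (trans (sumTo-last m g early) (cong 𝟙 atEnd))
  where
  C = consistentᵇ
  b = x ∷ xs
  g : ℕ → ℕ
  g p = 𝟙 (C (b ∷ bs) (ins p n w))
  m = pred (sum b)
  sb≡ : sum b ≡ suc m
  sb≡ = sym (suc-pred (sum b) {{>-nonZero (≤-trans (All.head pos) (m≤m+n x (sum xs)))}})
  u = take m w
  len-u : length u ≡ m
  len-u = length-take-≤ m w m≤w
  u-fills-b : suc (length u) ≡ sum b
  u-fills-b = trans (cong suc len-u) (sym sb≡)
  early : ∀ p → p < m → g p ≡ 0
  early p p<m = cong 𝟙 (trans (consistent-ins-inside b bs p m n w sb≡ (<⇒≤ p<m))
    (cong (_∧ C bs (drop m w))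
          (blockOK-early-max b p n u pos u-fills-b (All.take⁺ m w<n) (subst (p <_) (sym len-u) p<m))))
  atEnd : C (b ∷ bs) (ins m n w) ≡ C (reduceBlock b ++ bs) w
  atEnd = begin
    C (b ∷ bs) (ins m n w)
      ≡⟨ consistent-ins-inside b bs m m n w sb≡ ≤-refl ⟩
    blockOKᵇ b (ins m n u) ∧ C bs (drop m w)
      ≡⟨ cong (λ s → blockOKᵇ b s ∧ C bs (drop m w)) (trans (cong (λ k → ins k n u) (sym len-u)) (ins-end n u)) ⟩
    blockOKᵇ b (u ++ [ n ]) ∧ C bs (drop m w)
      ≡⟨ cong (_∧ C bs (drop m w)) (consistent-reduceBlock x xs n u pos u-fills-b (All.take⁺ m w<n)) ⟩
    C (reduceBlock b) (take m w) ∧ C bs (drop m w)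
      ≡⟨ cong (λ k → C (reduceBlock b) (take k w) ∧ C bs (drop k w)) (sym size-reduced) ⟩
    C (reduceBlock b) (take (size (reduceBlock b)) w) ∧ C bs (drop (size (reduceBlock b)) w)
      ≡⟨ sym (consistent-++ (reduceBlock b) bs w) ⟩
    C (reduceBlock b ++ bs) w ∎
    where
    open ≡-Reasoning
    size-reduced : size (reduceBlock b) ≡ m
    size-reduced = suc-injective (trans (reduceBlock-one-shorter x xs pos) sb≡)

-- Summing over the insertion positions p of a new largest letter n into a word w,
-- bs accepts ins p n w exactly when p is the end of some block i and the i-th
-- reduction of bs accepts w.
insertions-count : ∀ n bs w → All Block bs → All (_< n) w → length w ≡ pred (size bs) →
  sumTo (size bs) (λ p → 𝟙 (consistentᵇ bs (ins p n w))) ≡ count (λ r → consistentᵇ r w) (reductions bs)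
insertions-count n []                w _                      _   _   = refl
insertions-count n ([] ∷ bs)         w ((_ , ()) ∷ _)         _   _
insertions-count n ((x ∷ xs) ∷ bs) w ((pos , b>0) ∷ valid) w<n len = begin
  sumTo (sum b + size bs) g
    ≡⟨ sumTo-+ (sum b) (size bs) g ⟩
  sumTo (sum b) g + sumTo (size bs) (λ q → g (sum b + q))
    ≡⟨ cong₂ _+_ (insertions-first-block x xs bs n w pos w<n (subst (m ≤_) (sym len-w) (m≤m+n m (size bs))))
                 afterBlock ⟩
  count (λ r → C r w) (reductions (b ∷ bs)) ∎
  where
  open ≡-Reasoning
  C = consistentᵇ
  b = x ∷ xs
  g : ℕ → ℕ
  g p = 𝟙 (C (b ∷ bs) (ins p n w))
  m = pred (sum b)
  sb≡ : sum b ≡ suc m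
  sb≡ = sym (suc-pred (sum b) {{>-nonZero b>0}})
  len-w : length w ≡ m + size bs
  len-w = trans len (cong (λ k → pred (k + size bs)) sb≡)
  d = drop (sum b) w
  K = blockOKᵇ b (take (sum b) w)
  beyond : ∀ q → q < size bs → g (sum b + q) ≡ 𝟙 K * 𝟙 (C bs (ins q n d))
  beyond q q<bs = trans (cong 𝟙 (consistent-ins-beyond b bs q n w sb≤w)) (𝟙-∧ K _)
    where
    sb≤w : sum b ≤ length w
    sb≤w = subst₂ _≤_ (sym sb≡) (sym len-w)
                  (≤-trans (≤-reflexive (+-comm 1 m)) (+-monoʳ-≤ m (≤-trans z<s q<bs)))
  len-d : length d ≡ pred (size bs)
  len-d = trans (length-drop (sum b) w) (begin
    length w ∸ sum b        ≡⟨ cong₂ _∸_ len-w sb≡ ⟩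
    (m + size bs) ∸ suc m   ≡⟨ sym (pred[m∸n]≡m∸[1+n] (m + size bs) m) ⟩
    pred (m + size bs ∸ m)  ≡⟨ cong pred (m+n∸m≡n m (size bs)) ⟩
    pred (size bs)          ∎)
  afterBlock : sumTo (size bs) (λ q → g (sum b + q)) ≡ count (λ r → C r w) (map (b ∷_) (reductions bs))
  afterBlock = begin
    sumTo (size bs) (λ q → g (sum b + q))
      ≡⟨ sumTo-cong (size bs) beyond ⟩
    sumTo (size bs) (λ q → 𝟙 K * 𝟙 (C bs (ins q n d)))
      ≡⟨ sumTo-*ˡ (size bs) (𝟙 K) _ ⟩
    𝟙 K * sumTo (size bs) (λ q → 𝟙 (C bs (ins q n d)))
      ≡⟨ cong (𝟙 K *_) (insertions-count n bs d valid (All.drop⁺ (sum b) w<n) len-d) ⟩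
    𝟙 K * count (λ r → C r d) (reductions bs)
      ≡⟨ sum-map-*ˡ (𝟙 K) (λ r → 𝟙 (C r d)) (reductions bs) ⟩
    sum (map (λ r → 𝟙 K * 𝟙 (C r d)) (reductions bs))
      ≡⟨ cong sum (map-cong (λ r → sym (𝟙-∧ K (C r d))) (reductions bs)) ⟩
    sum (map (λ r → 𝟙 (C (b ∷ r) w)) (reductions bs))
      ≡⟨ cong sum (map-∘ (reductions bs)) ⟩
    count (λ r → C r w) (map (b ∷_) (reductions bs)) ∎

Perm : ℕ → List ℕ → Set
Perm n w = All (_< n) w × Unique w × length w ≡ n

insertions : ℕ → List ℕ → List (List ℕ)
insertions n w = applyUpTo (λ p → ins p n w) (suc n)

perms : ℕ → List (List ℕ)
perms zero    = [ [] ]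
perms (suc n) = concatMap (insertions n) (perms n)

unique-ins : ∀ p x w → Unique w → All (x ≢_) w → Unique (ins p x w)
unique-ins zero    x w       uw        x∉w         = x∉w ∷ uw
unique-ins (suc p) x []      _         _           = [] ∷ []
unique-ins (suc p) x (y ∷ w) (y∉w ∷ uw) (x≢y ∷ x∉w) =
  All-ins p x w (λ y≡x → x≢y (sym y≡x)) y∉w ∷ unique-ins p x w uw x∉w

erase : ℕ → List ℕ → List ℕ
erase x []      = []
erase x (y ∷ w) = if y ≡ᵇ x then erase x w else y ∷ erase x w

erase-absent : ∀ x w → All (x ≢_) w → erase x w ≡ w
erase-absent x []      _           = refl
erase-absent x (y ∷ w) (x≢y ∷ x∉w)
  rewrite ¬T⇒≡false (λ t → x≢y (sym (≡ᵇ⇒≡ y x t))) = cong (y ∷_) (erase-absent x w x∉w)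

erase-ins : ∀ p x w → All (x ≢_) w → erase x (ins p x w) ≡ w
erase-ins zero    x w       x∉w rewrite T⇒≡true (≡⇒≡ᵇ x x refl) = erase-absent x w x∉w
erase-ins (suc p) x []      _   rewrite T⇒≡true (≡⇒≡ᵇ x x refl) = refl
erase-ins (suc p) x (y ∷ w) (x≢y ∷ x∉w)
  rewrite ¬T⇒≡false (λ t → x≢y (sym (≡ᵇ⇒≡ y x t))) = cong (y ∷_) (erase-ins p x w x∉w)

ins-injective : ∀ i j x w → i < j → j ≤ length w → All (x ≢_) w → ins i x w ≢ ins j x w
ins-injective zero    (suc j) x (y ∷ w) _         _         (x≢y ∷ _)   eq = x≢y (proj₁ (∷-injective eq))
ins-injective (suc i) (suc j) x (y ∷ w) (s<s i<j) (s≤s j≤w) (_ ∷ x∉w) eq =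
  ins-injective i j x w i<j j≤w x∉w (proj₂ (∷-injective eq))

absent-above : ∀ {m} w → All (_< m) w → All (m ≢_) w
absent-above w = All.map (λ y<m m≡y → <-irrefl (sym m≡y) y<m)

below-max : ∀ {m} w → All (_< suc m) w → All (m ≢_) w → All (_< m) w
below-max []      []            []          = []
below-max (y ∷ w) (y<1+m ∷ w<) (m≢y ∷ m∉w) =
  ≤∧≢⇒< (≤-pred y<1+m) (λ y≡m → m≢y (sym y≡m)) ∷ below-max w w< m∉w

unique-remove : ∀ (xs : List ℕ) m ys → Unique (xs ++ m ∷ ys) → Unique (xs ++ ys) × All (m ≢_) (xs ++ ys)
unique-remove []       m ys (m∉ys ∷ u) = u , m∉ys
unique-remove (x ∷ xs) m ys (x∉ ∷ u) =
  (All.++⁺ (proj₁ x∉split) (All.tail (proj₂ x∉split)) ∷ proj₁ rest) ,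
  ((λ m≡x → All.head (proj₂ x∉split) (sym m≡x)) ∷ proj₂ rest)
  where
  rest = unique-remove xs m ys u
  x∉split = All.++⁻ xs x∉

remove-max : ∀ m (xs ys : List ℕ) → All (_< suc m) (xs ++ m ∷ ys) → Unique (xs ++ m ∷ ys) →
             All (_< m) (xs ++ ys) × Unique (xs ++ ys)
remove-max m xs ys bounded uniq =
  below-max (xs ++ ys) (All.++⁺ (proj₁ split) (All.tail (proj₂ split))) (proj₂ removed) , proj₁ removed
  where
  split = All.++⁻ xs bounded
  removed = unique-remove xs m ys uniq

unique-length-≤ : ∀ n w → Unique w → All (_< n) w → length w ≤ n
unique-length-≤ zero    []      _ _          = z≤n
unique-length-≤ zero    (y ∷ w) _ (() ∷ _)
unique-length-≤ (suc m) w       u w<1+m with m ∈? w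
... | no m∉w = m≤n⇒m≤1+n (unique-length-≤ m w u (below-max w w<1+m (All.¬Any⇒All¬ w m∉w)))
... | yes m∈w with ∈-∃++ m∈w
...   | xs , ys , refl =
  let (w′<m , uw′) = remove-max m xs ys w<1+m u
  in subst (_≤ suc m) (sym (length-++-sucʳ xs m ys)) (s≤s (unique-length-≤ m (xs ++ ys) uw′ w′<m))

perms-sound : ∀ n {w} → w ∈ perms n → Perm n w
perms-sound zero    (here refl) = [] , [] , refl
perms-sound (suc m) w∈ with find (∈-concatMap⁻ (insertions m) {xs = perms m} w∈)
... | w′ , w′∈ , w∈ins with ∈-applyUpTo⁻ (λ p → ins p m w′) w∈ins
...   | p , _ , refl =
  let (w′<m , uw′ , len) = perms-sound m w′∈
  in All-ins p m w′ (n<1+n m) (All.map m<n⇒m<1+n w′<m) ,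
     unique-ins p m w′ uw′ (absent-above w′ w′<m) ,
     trans (length-ins p m w′) (cong suc len)

perms-complete : ∀ n w → Perm n w → w ∈ perms n
perms-complete zero    []      _                  = here refl
perms-complete zero    (_ ∷ _) (_ , _ , ())
perms-complete (suc m) w       (w<1+m , uw , len) with m ∈? w
... | no m∉w = ⊥-elim (1+n≰n (subst (_≤ m) len
                 (unique-length-≤ m w uw (below-max w w<1+m (All.¬Any⇒All¬ w m∉w)))))
... | yes m∈w with ∈-∃++ m∈w
...   | xs , ys , refl = ∈-concatMap⁺ (insertions m) (lose rest∈ w∈insertions)
  where
  rest = remove-max m xs ys w<1+m uw
  len-rest : length (xs ++ ys) ≡ m
  len-rest = suc-injective (trans (sym (length-++-sucʳ xs m ys)) len)
  rest∈ : xs ++ ys ∈ perms m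
  rest∈ = perms-complete m (xs ++ ys) (proj₁ rest , proj₂ rest , len-rest)
  xs≤m : length xs ≤ m
  xs≤m = subst (length xs ≤_) (trans (sym (length-++ xs)) len-rest) (m≤m+n (length xs) (length ys))
  w∈insertions : xs ++ m ∷ ys ∈ insertions m (xs ++ ys)
  w∈insertions = subst (_∈ insertions m (xs ++ ys)) (ins-++ xs m ys)
                       (∈-applyUpTo⁺ (λ p → ins p m (xs ++ ys)) (s≤s xs≤m))

perms-unique : ∀ n → Unique (perms n)
perms-unique zero    = [] ∷ []
perms-unique (suc m) = insertions-unique (perms m) (perms-unique m) (All.tabulate (perms-sound m))
  where
  insertions-unique : ∀ ws → Unique ws → All (Perm m) ws → Unique (concatMap (insertions m) ws)
  insertions-unique []       _            _                        = []
  insertions-unique (w ∷ ws) (w∉ws ∷ uws) ((w<m , _ , len) ∷ pws) =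
    Unique.++⁺ distinct (insertions-unique ws uws pws) disjoint
    where
    distinct : Unique (insertions m w)
    distinct = Unique.applyUpTo⁺₁ (λ p → ins p m w) (suc m)
      (λ i<j j<1+m → ins-injective _ _ m w i<j (subst (_ ≤_) (sym len) (≤-pred j<1+m)) (absent-above w w<m))
    -- Erasing m recovers the word that m was inserted into.
    disjoint : ∀ {v} → ¬ (v ∈ insertions m w × v ∈ concatMap (insertions m) ws)
    disjoint (v∈ , v∈′) with ∈-applyUpTo⁻ (λ p → ins p m w) v∈ | find (∈-concatMap⁻ (insertions m) {xs = ws} v∈′)
    ... | p , _ , refl | w′ , w′∈ws , v∈ins′ with ∈-applyUpTo⁻ (λ q → ins q m w′) v∈ins′
    ...   | q , _ , eq = All.lookup w∉ws w′∈ws (begin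
      w                 ≡⟨ sym (erase-ins p m w (absent-above w w<m)) ⟩
      erase m (ins p m w)  ≡⟨ cong (erase m) eq ⟩
      erase m (ins q m w′) ≡⟨ erase-ins q m w′ (absent-above w′ (proj₁ (All.lookup pws w′∈ws))) ⟩
      w′                ∎)
      where open ≡-Reasoning

count-perms-step : ∀ n bs → All Block bs → size bs ≡ suc n →
  count (consistentᵇ bs) (perms (suc n)) ≡ sum (map (λ r → count (consistentᵇ r) (perms n)) (reductions bs))
count-perms-step n bs valid size≡ = begin
  count (consistentᵇ bs) (concatMap (insertions n) (perms n))
    ≡⟨ count-concatMap (consistentᵇ bs) (insertions n) (perms n) ⟩
  sum (map (λ w → count (consistentᵇ bs) (insertions n w)) (perms n))
    ≡⟨ sum-map-cong (All.tabulate (perms-sound n)) perWord ⟩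
  sum (map (λ w → count (λ r → consistentᵇ r w) (reductions bs)) (perms n))
    ≡⟨ count-swap consistentᵇ (reductions bs) (perms n) ⟩
  sum (map (λ r → count (consistentᵇ r) (perms n)) (reductions bs)) ∎
  where
  open ≡-Reasoning
  perWord : ∀ {w} → Perm n w →
            count (consistentᵇ bs) (insertions n w) ≡ count (λ r → consistentᵇ r w) (reductions bs)
  perWord {w} (w<n , _ , len) = begin
    count (consistentᵇ bs) (insertions n w)
      ≡⟨ count-applyUpTo (consistentᵇ bs) (λ p → ins p n w) (suc n) ⟩
    sumTo (suc n) (λ p → 𝟙 (consistentᵇ bs (ins p n w)))
      ≡⟨ cong (λ k → sumTo k (λ p → 𝟙 (consistentᵇ bs (ins p n w)))) (sym size≡) ⟩
    sumTo (size bs) (λ p → 𝟙 (consistentᵇ bs (ins p n w)))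
      ≡⟨ insertions-count n bs w valid w<n (trans len (cong pred (sym size≡))) ⟩
    count (λ r → consistentᵇ r w) (reductions bs) ∎

count-perms : ∀ n bs → All Block bs → size bs ≡ n → count (consistentᵇ bs) (perms n) * πblocks bs ≡ n !
count-perms zero    []       _                  _     = refl
count-perms zero    (b ∷ bs) ((_ , b>0) ∷ _)    size≡ =
  ⊥-elim (<⇒≢ (≤-trans b>0 (m≤m+n (sum b) (size bs))) (sym size≡))
count-perms (suc n) bs       valid              size≡ = begin
  count (consistentᵇ bs) (perms (suc n)) * πblocks bs
    ≡⟨ cong (_* πblocks bs) (count-perms-step n bs valid size≡) ⟩
  sum (map (λ r → count (consistentᵇ r) (perms n)) (reductions bs)) * πblocks bs
    ≡⟨ reductions-weighted bs valid (λ r → count (consistentᵇ r) (perms n)) (n !)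
         (All.map (λ { {r} (valid-r , size-r) → count-perms n r valid-r (suc-injective (trans size-r size≡)) })
                  (reductions-valid bs valid)) ⟩
  n ! * size bs
    ≡⟨ cong (n ! *_) size≡ ⟩
  n ! * suc n
    ≡⟨ *-comm (n !) (suc n) ⟩
  suc n ! ∎
  where open ≡-Reasoning

-- The permutations
-- among the words allWords n n, read in one-line notation, are a rearrangement of
-- perms n (both lists are duplicate-free with the same members).

allWords-unique : ∀ n k → Unique (allWords n k)
allWords-unique n zero    = [] ∷ []
allWords-unique n (suc k) =
  Unique.concat⁺ (All.map⁺ (All.tabulate (λ _ → Unique.map⁺ VecP.∷-injectiveʳ (allWords-unique n k))))
                 (AllPairs.map⁺ (AllPairs.map distinct-heads (Unique.allFin⁺ n)))
  where
  words-from : Fin n → List (Vec (Fin n) (suc k))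
  words-from i = map (i Vec.∷_) (allWords n k)
  distinct-heads : ∀ {i j} → i ≢ j → ∀ {v} → ¬ (v ∈ words-from i × v ∈ words-from j)
  distinct-heads i≢j (v∈i , v∈j) with ∈-map⁻ (_ Vec.∷_) v∈i | ∈-map⁻ (_ Vec.∷_) v∈j
  ... | _ , _ , refl | _ , _ , eq = i≢j (VecP.∷-injectiveˡ eq)

allWords-complete : ∀ n k (v : Vec (Fin n) k) → v ∈ allWords n k
allWords-complete n zero    Vec.[]       = here refl
allWords-complete n (suc k) (i Vec.∷ v) =
  ∈-concatMap⁺ (λ i → map (i Vec.∷_) (allWords n k))
               (lose (∈-allFin i) (∈-map⁺ (i Vec.∷_) (allWords-complete n k v)))

isPerm? : ∀ {n} (v : Vec (Fin n) n) → Dec (IsPerm v)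
isPerm? {n} v = UDec.unique? (Fin._≟_ {n}) (toList v)

permWords : ℕ → List (List ℕ)
permWords n = map oneLine (filter isPerm? (allWords n n))

oneLine-injective : ∀ {n} {v v′ : Vec (Fin n) n} → oneLine v ≡ oneLine v′ → v ≡ v′
oneLine-injective {v = v} {v′} eq =
  trans (sym (cast-is-id refl v)) (VecP.toList-injective refl v v′ (map-injective Fin.toℕ-injective eq))

fromWord : ∀ {n} k (w : List ℕ) → length w ≡ k → All (_< n) w → Σ (Vec (Fin n) k) λ v → map toℕ (toList v) ≡ w
fromWord zero    []      refl []          = Vec.[] , refl
fromWord (suc k) (x ∷ w) len  (x<n ∷ w<n) =
  let (v , v≡w) = fromWord k w (suc-injective len) w<n
  in (fromℕ< x<n Vec.∷ v) , cong₂ _∷_ (Fin.toℕ-fromℕ< x<n) v≡w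

permWords-sound : ∀ n {w} → w ∈ permWords n → Perm n w
permWords-sound n w∈ with ∈-map⁻ oneLine w∈
... | v , v∈ , refl =
  All.map⁺ (All.tabulate (λ {i} _ → Fin.toℕ<n i)) ,
  Unique.map⁺ Fin.toℕ-injective (proj₂ (∈-filter⁻ isPerm? {xs = allWords n n} v∈)) ,
  trans (length-map toℕ (toList v)) (VecP.length-toList v)

permWords-complete : ∀ n w → Perm n w → w ∈ permWords n
permWords-complete n w (w<n , uw , len) =
  subst (_∈ permWords n) v≡w
        (∈-map⁺ oneLine (∈-filter⁺ isPerm? (allWords-complete n n v) (Unique.map⁻ (subst Unique (sym v≡w) uw))))
  where
  v = proj₁ (fromWord n w len w<n)
  v≡w = proj₂ (fromWord n w len w<n)

permWords↭perms : ∀ n → permWords n ↭ perms n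
permWords↭perms n = ∼bag⇒↭ (unique∧set⇒bag
  (Unique.map⁺ oneLine-injective (Unique.filter⁺ isPerm? (allWords-unique n n))) (perms-unique n)
  (λ {w} → mk⇔ (λ w∈ → perms-complete n w (permWords-sound n w∈))
               (λ w∈ → permWords-complete n w (perms-sound n w∈))))

length-Cons : ∀ {n} (f : List ℕ → Bool) (vs : List (Vec (Fin n) n)) →
  length (filter (λ v → isPerm? v ×-dec T? (f (oneLine v))) vs) ≡ count f (map oneLine (filter isPerm? vs))
length-Cons f []       = refl
length-Cons f (v ∷ vs) with isPerm? v
... | no _  = length-Cons f vs
... | yes _ with f (oneLine v)
...   | true  = cong suc (length-Cons f vs)
...   | false = length-Cons f vs

lemma3p9 : (n : ℕ) (α β : List ℕ) → IsComposition n α → IsComposition n β →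
           (r : α ≼ β) → n ! ≡ ∣Cons∣ n r * π₂ r
lemma3p9 n α β (α>0 , _) (β>0 , Σβ≡n) r@(bs , concat≡α , sums≡β) = sym (begin
  ∣Cons∣ n r * πblocks bs
    ≡⟨ cong (_* πblocks bs) (length-Cons (consistentᵇ bs) (allWords n n)) ⟩
  count (consistentᵇ bs) (permWords n) * πblocks bs
    ≡⟨ cong (_* πblocks bs) (count-↭ (consistentᵇ bs) (permWords↭perms n)) ⟩
  count (consistentᵇ bs) (perms n) * πblocks bs
    ≡⟨ count-perms n bs blocks size≡n ⟩
  n ! ∎)
  where
  open ≡-Reasoning
  blocks : All Block bs
  blocks = All.zip (All.concat⁻ (subst (All (0 <_)) (sym concat≡α) α>0) ,
                    All.map⁻ (subst (All (0 <_)) (sym sums≡β) β>0))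
  size≡n : size bs ≡ n
  size≡n = trans (cong sum sums≡β) Σβ≡n
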